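{- If a $3$-uniform hypergraph $F$ on $\ell$ vertices is frequent, then $F$ is (isomorphic to) a subhypergraph of the ternary hypergraph $T_\ell$.
   Context: All hypergraphs are finite and $3$-uniform; $U^{(3)}$ is the set of $3$-element subsets of $U$. The ternary hypergraph $T_n$ has vertex set $\{0,1,2\}^n$; three distinct vertices $\mathbf{x},\mathbf{y},\mathbf{z}$ form a hyperedge iff for the least index $i$ with $x_i=y_i=z_i$ failing one has $\{x_i,y_i,z_i\}=\{0,1,2\}$. For a function $d\colon(0,1)\to(0,1)$, a sequence $(H_n)_{n\in\mathbb{N}}$ of hypergraphs with $|V(H_n)|\to\infty$ is $d$-dense if for every $\eta\in(0,1)$ there is $n_0$ such that for all $n\ge n_0$ every $U\subseteq V(H_n)$ with $|U|\ge\eta|V(H_n)|$ satisfies $|U^{(3)}\cap E(H_n)|\ge d(\eta)\binom{|U|}{3}$. A hypergraph $F$ is frequent if for every function $d\colon(0,1)\to(0,1)$ and every $d$-dense sequence $(H_n)_{n\in\mathbb{N}}$ there is $n_0$ such that $F$ is a subhypergraph (up to isomorphism) of every $H_n$ with $n\ge n_0$.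
   Formalization: The parameter η and the arguments and values of each density function d are taken in the rationals strictly between 0 and 1 instead of the real interval (0,1). -}

module Defs where

open import Data.Nat as ℕ using (ℕ; zero; suc; _≤ᵇ_)
open import Data.Nat.Combinatorics using (_C_)
open import Data.Bool using (Bool; true; false; T; _∧_)
open import Data.Fin using (Fin; toℕ)
open import Data.Fin.Subset using (Subset; _∈_; ∣_∣)
open import Data.Vec using (Vec; []; _∷_; lookup)
open import Data.List using (List; length; filterᵇ; concatMap; allFin; [_]; [])
open import Data.Product using (Σ; _×_; _,_; ∃)
open import Data.Sum using (_⊎_)
open import Data.Empty using (⊥)
open import Data.Integer using (+_)
open import Data.Rational using (ℚ; _/_; _*_; _≤_; _<_; 0ℚ; 1ℚ)
open import Relation.Binary.PropositionalEquality using (_≡_; _≢_)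
open import Relation.Nullary using (does)
open import Function.Definitions using (Injective)

-- Edges are given by a Boolean predicate on ordered triples which is
-- invariant under permutations and false on triples with a repeated
-- vertex; the hyperedge {x,y,z} is present iff edge x y z ≡ true.
record Hypergraph : Set where
  field
    V      : ℕ
    edge   : Fin V → Fin V → Fin V → Bool
    sym₁₂  : ∀ x y z → edge x y z ≡ edge y x z
    sym₂₃  : ∀ x y z → edge x y z ≡ edge x z y
    loop   : ∀ x z → edge x x z ≡ false

open Hypergraph public

Edge : (H : Hypergraph) → Fin (V H) → Fin (V H) → Fin (V H) → Set
Edge H x y z = T (edge H x y z)

-- F is (isomorphic to) a subhypergraph of a hypergraph on vertex type B
-- with edge relation E: there is an injective map of vertices sending
-- hyperedges to hyperedges.
EmbedsInto : (F : Hypergraph) {B : Set} → (B → B → B → Set) → Set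
EmbedsInto F {B} E =
  Σ (Fin (V F) → B) λ f →
    Injective _≡_ _≡_ f × (∀ x y z → Edge F x y z → E (f x) (f y) (f z))

_⊑_ : Hypergraph → Hypergraph → Set
F ⊑ H = EmbedsInto F (Edge H)

-- TernEdge x y z: at the least index where x_i = y_i = z_i fails,
-- {x_i, y_i, z_i} = {0,1,2} (i.e. the three entries are pairwise distinct);
-- if no such index exists (x = y = z), there is no edge.
TernEdge : ∀ {n} → Vec (Fin 3) n → Vec (Fin 3) n → Vec (Fin 3) n → Set
TernEdge [] [] [] = ⊥
TernEdge (a ∷ xs) (b ∷ ys) (c ∷ zs) =
  (a ≡ b × b ≡ c × TernEdge xs ys zs) ⊎ (a ≢ b × b ≢ c × a ≢ c)

_⊑T_ : Hypergraph → ℕ → Set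
F ⊑T n = EmbedsInto F (TernEdge {n})

edgesIn : (H : Hypergraph) → Subset (V H) → ℕ
edgesIn H U = length (filterᵇ ok triples)
  where
    lt : Fin (V H) → Fin (V H) → Bool
    lt i j = suc (toℕ i) ≤ᵇ toℕ j
    inU : Fin (V H) → Bool
    inU i = lookup U i
    triples : List (Fin (V H) × Fin (V H) × Fin (V H))
    triples = concatMap (λ i → concatMap (λ j → concatMap (λ k →
                [ (i , j , k) ]) (allFin (V H))) (allFin (V H))) (allFin (V H))
    ok : Fin (V H) × Fin (V H) × Fin (V H) → Bool
    ok (i , j , k) = lt i j ∧ lt j k ∧ inU i ∧ inU j ∧ inU k ∧ edge H i j k

ℕ→ℚ : ℕ → ℚ
ℕ→ℚ n = + n / 1

InUnit : ℚ → Set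
InUnit η = 0ℚ < η × η < 1ℚ

DensityFn : Set
DensityFn = Σ (ℚ → ℚ) λ d → ∀ η → InUnit η → InUnit (d η)

Unbounded : (ℕ → Hypergraph) → Set
Unbounded H = ∀ M → ∃ λ n₀ → ∀ n → n₀ ℕ.≤ n → M ℕ.≤ V (H n)

Dense : DensityFn → (ℕ → Hypergraph) → Set
Dense (d , _) H =
  Unbounded H ×
  (∀ η → InUnit η → ∃ λ n₀ → ∀ n → n₀ ℕ.≤ n → (U : Subset (V (H n))) →
     η * ℕ→ℚ (V (H n)) ≤ ℕ→ℚ ∣ U ∣ →
     d η * ℕ→ℚ (∣ U ∣ C 3) ≤ ℕ→ℚ (edgesIn (H n) U))

Frequent : Hypergraph → Set
Frequent F = (d : DensityFn) (H : ℕ → Hypergraph) → Dense d H →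
  ∃ λ n₀ → ∀ n → n₀ ℕ.≤ n → F ⊑ H n

module Submission where

-- Proof.  (1) The sequence (T_n) is d-dense for an explicit d.  The core is a counting
-- lemma: a set S of distinct words in {0,1,2}ⁿ of size at least (4/3)(3/4)ʲ 3ⁿ (j ≤ n)
-- spans at least 27ⁿ / D_j hyperedges, by induction on j after splitting S by first
-- letter: either all three parts are large and the triples across the parts are
-- hyperedges, or one part is denser by a factor 4/3 and induction applies to it.
-- Given η = u/q, the level j = 4q makes every U with |U| ≥ η 3ⁿ dense enough, and
-- d(η) = 1/(D_j + 2) converts this into the rational density condition.
-- (2) Hence a frequent F embeds into some T_n.  (3) Compression: relative to the ℓ
-- image words, delete every coordinate on which the words of the current branch
-- agree; at most ℓ coordinates survive along any branch, which embeds F into T_ℓ.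

open import Defs

open import Data.Bool using (Bool; true; false; T; _∧_)
open import Data.Empty using (⊥-elim)
open import Data.Fin as Fin using (Fin; toℕ; combine; remQuot) renaming (zero to 0F; suc to sucF)
open import Data.Fin.Properties using (remQuot-combine; combine-remQuot; combine-monoˡ-<; toℕ-combine; any?)
open import Data.Fin.Subset using (Subset; ∣_∣)
open import Data.Fin.Subset.Properties using (∣p∣≤n)
open import Data.Integer as ℤ using (+_; +[1+_]; -[1+_]; +≤+; +<+)
open import Data.Integer.Properties using (pos-*; drop‿+≤+)
open import Data.List using (List; []; _∷_; length; map; filter; filterᵇ; concatMap; allFin; tabulate; cartesianProduct; [_])
open import Data.List.Membership.Propositional using (_∈_)
open import Data.List.Membership.Propositional.Properties using (∈-map⁺; ∈-map⁻; ∈-filter⁺; ∈-filter⁻; ∈-allFin; ∈-concatMap⁺; ∈-cartesianProduct⁻)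
open import Data.List.Properties using (length-map; length-filter; filter-notAll; length-tabulate; length-++; length-removeAt′)
open import Data.List.Relation.Unary.All as All using (All; []; _∷_)
open import Data.List.Relation.Unary.All.Properties as All using (¬All⇒Any¬; all-filter)
open import Data.List.Relation.Unary.AllPairs using ([]; _∷_)
open import Data.List.Relation.Unary.Any as Any using (here; there; index; _─_)
open import Data.List.Relation.Unary.Unique.Propositional using (Unique)
open import Data.List.Relation.Unary.Unique.Propositional.Properties as Unique using (filter⁺; allFin⁺; cartesianProduct⁺)
open import Data.Nat using (ℕ; zero; suc; _+_; _*_; _^_; _≤_; _<_; z≤n; s≤s; _≤?_; _≤ᵇ_)
open import Data.Nat.Combinatorics using (_C_; nCk+nC[k+1]≡[n+1]C[k+1])
open import Data.Nat.Coprimality using (Coprime; 1-coprimeTo) renaming (sym to coprime-sym)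
open import Data.Nat.Properties as ℕP using (≤-refl; ≤-trans; ≤-reflexive; *-mono-≤; +-mono-≤)
open import Data.Nat.Tactic.RingSolver using (solve-∀)
open import Data.Product using (_×_; _,_; proj₁; proj₂)
open import Data.Rational as ℚ using (ℚ; mkℚ; ↧ₙ_; 0ℚ)
open import Data.Rational.Properties using (toℚᵘ-mono-≤; toℚᵘ-cancel-≤; toℚᵘ-homo-*; normalize-coprime)
open import Data.Rational.Unnormalised using (*≤*)
open import Data.Rational.Unnormalised.Properties using (≤-respˡ-≃; ≃-sym)
open import Data.Sum using (_⊎_; inj₁; inj₂)
open import Data.Vec using (Vec; []; _∷_; head; tail; replicate; lookup)
open import Data.Vec.Properties using (∷-injective; ∷-injectiveʳ)
open import Data.Vec.Relation.Binary.Lex.Strict using (Lex-<; base; this; next)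
open import Function.Base using (_∘_)
open import Function.Bundles using (_⇔_; mk⇔; Equivalence)
open import Function.Definitions using (Injective)
open import Relation.Binary.PropositionalEquality using (_≡_; _≢_; refl; sym; trans; cong; cong₂; subst; subst₂)
open import Relation.Nullary using (Dec; yes; no; does; ¬_)
open import Relation.Nullary.Decidable using (_×-dec_; _⊎-dec_; ¬?; does-⇔; dec-false; T?)

open ℕP.≤-Reasoning

does-sound : ∀ {A : Set} (a? : Dec A) → T (does a?) → A
does-sound (yes a) _ = a

does-complete : ∀ {A : Set} (a? : Dec A) → A → T (does a?)
does-complete (yes _) _ = _
does-complete (no ¬a) a = ¬a a

∧-intro : ∀ {x y} → T x → T y → T (x ∧ y)
∧-intro {true} _ ty = ty

∈⇒nonempty : ∀ {A : Set} {x : A} {S : List A} → x ∈ S → ¬ length S ≤ 0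
∈⇒nonempty (here _)  ()
∈⇒nonempty (there _) ()

∈-─ : ∀ {A : Set} {x z : A} {ys : List A} (x∈ys : x ∈ ys) → z ∈ ys → z ≢ x → z ∈ (ys ─ x∈ys)
∈-─ (here refl) (here z≡x)    z≢x = ⊥-elim (z≢x z≡x)
∈-─ (here refl) (there z∈ys)  _   = z∈ys
∈-─ (there _)   (here z≡y)    _   = here z≡y
∈-─ (there x∈ys) (there z∈ys) z≢x = there (∈-─ x∈ys z∈ys z≢x)

unique-⊆-length : ∀ {A : Set} {xs ys : List A} → Unique xs → (∀ {x} → x ∈ xs → x ∈ ys) →
  length xs ≤ length ys
unique-⊆-length {xs = []}     _               _  = z≤n
unique-⊆-length {xs = x ∷ xs} {ys} (x∉xs ∷ u) xs⊆ys = begin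
  suc (length xs)              ≤⟨ s≤s (unique-⊆-length u xs⊆ys─x) ⟩
  suc (length (ys ─ x∈ys))     ≡⟨ sym (length-removeAt′ ys (index x∈ys)) ⟩
  length ys                    ∎
  where
  x∈ys = xs⊆ys (here refl)
  xs⊆ys─x : ∀ {z} → z ∈ xs → z ∈ (ys ─ x∈ys)
  xs⊆ys─x z∈xs = ∈-─ x∈ys (xs⊆ys (there z∈xs)) (λ z≡x → All.lookup x∉xs z∈xs (sym z≡x))

length-cartesianProduct : ∀ {A B : Set} (xs : List A) (ys : List B) →
  length (cartesianProduct xs ys) ≡ length xs * length ys
length-cartesianProduct []       ys = refl
length-cartesianProduct (x ∷ xs) ys =
  trans (length-++ (map (x ,_) ys)) (cong₂ _+_ (length-map (x ,_) ys) (length-cartesianProduct xs ys))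

toFin : ∀ {k} n → Vec (Fin k) n → Fin (k ^ n)
toFin zero    []      = 0F
toFin (suc n) (c ∷ w) = combine c (toFin n w)

fromFin : ∀ {k} n → Fin (k ^ n) → Vec (Fin k) n
fromFin         zero    _ = []
fromFin {k = k} (suc n) i = proj₁ (remQuot {k} (k ^ n) i) ∷ fromFin n (proj₂ (remQuot {k} (k ^ n) i))

fromFin-toFin : ∀ {k} n (w : Vec (Fin k) n) → fromFin n (toFin n w) ≡ w
fromFin-toFin         zero    []      = refl
fromFin-toFin {k = k} (suc n) (c ∷ w) =
  cong₂ _∷_ (cong proj₁ qr) (trans (cong (λ p → fromFin n (proj₂ p)) qr) (fromFin-toFin n w))
  where
  qr : remQuot {k} (k ^ n) (combine c (toFin n w)) ≡ (c , toFin n w)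
  qr = remQuot-combine {k = k ^ n} c (toFin n w)

toFin-fromFin : ∀ {k} n (i : Fin (k ^ n)) → toFin n (fromFin n i) ≡ i
toFin-fromFin         zero    0F = refl
toFin-fromFin {k = k} (suc n) i =
  trans (cong (combine (proj₁ qr)) (toFin-fromFin n (proj₂ qr))) (combine-remQuot {k} (k ^ n) i)
  where
  qr = remQuot {k} (k ^ n) i

fromFin-injective : ∀ {k} n → Injective _≡_ _≡_ (fromFin {k} n)
fromFin-injective n {i} {j} eq =
  trans (sym (toFin-fromFin n i)) (trans (cong (toFin n) eq) (toFin-fromFin n j))

toFin-injective : ∀ {k} n → Injective _≡_ _≡_ (toFin {k} n)
toFin-injective n {v} {w} eq =
  trans (sym (fromFin-toFin n v)) (trans (cong (fromFin n) eq) (fromFin-toFin n w))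

_<ₗₑₓ_ : ∀ {k n} → Vec (Fin k) n → Vec (Fin k) n → Set
_<ₗₑₓ_ = Lex-< _≡_ Fin._<_

toFin-mono : ∀ {k} n {v w : Vec (Fin k) n} → v <ₗₑₓ w → toFin n v Fin.< toFin n w
toFin-mono zero (base ())
toFin-mono (suc n) (this a<b _) = combine-monoˡ-< _ _ a<b
toFin-mono {k} (suc n) {a ∷ v} {.a ∷ w} (next refl v<w) =
  subst₂ _<_ (sym (toℕ-combine a (toFin n v))) (sym (toℕ-combine a (toFin n w)))
    (ℕP.+-monoʳ-< (k ^ n * toℕ a) (toFin-mono n v<w))

Word : ℕ → Set
Word n = Vec (Fin 3) n

1F 2F : Fin 3
1F = sucF 0F
2F = sucF (sucF 0F)

ternEdge? : ∀ {n} (x y z : Word n) → Dec (TernEdge x y z)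
ternEdge? [] [] [] = no λ ()
ternEdge? (a ∷ xs) (b ∷ ys) (c ∷ zs) =
  (a Fin.≟ b ×-dec (b Fin.≟ c ×-dec ternEdge? xs ys zs)) ⊎-dec
  (¬? (a Fin.≟ b) ×-dec (¬? (b Fin.≟ c) ×-dec ¬? (a Fin.≟ c)))

ternEdge-swap₁₂ : ∀ {n} {x y z : Word n} → TernEdge x y z → TernEdge y x z
ternEdge-swap₁₂ {x = []} {[]} {[]} ()
ternEdge-swap₁₂ {x = _ ∷ _} {_ ∷ _} {_ ∷ _} (inj₁ (a≡b , b≡c , t)) =
  inj₁ (sym a≡b , trans a≡b b≡c , ternEdge-swap₁₂ t)
ternEdge-swap₁₂ {x = _ ∷ _} {_ ∷ _} {_ ∷ _} (inj₂ (a≢b , b≢c , a≢c)) =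
  inj₂ ((λ b≡a → a≢b (sym b≡a)) , a≢c , b≢c)

ternEdge-swap₂₃ : ∀ {n} {x y z : Word n} → TernEdge x y z → TernEdge x z y
ternEdge-swap₂₃ {x = []} {[]} {[]} ()
ternEdge-swap₂₃ {x = _ ∷ _} {_ ∷ _} {_ ∷ _} (inj₁ (a≡b , b≡c , t)) =
  inj₁ (trans a≡b b≡c , sym b≡c , ternEdge-swap₂₃ t)
ternEdge-swap₂₃ {x = _ ∷ _} {_ ∷ _} {_ ∷ _} (inj₂ (a≢b , b≢c , a≢c)) =
  inj₂ (a≢c , (λ c≡b → b≢c (sym c≡b)) , a≢b)

ternEdge-irrefl : ∀ {n} {x z : Word n} → ¬ TernEdge x x z
ternEdge-irrefl {x = []} {[]} ()
ternEdge-irrefl {x = _ ∷ _} {_ ∷ _} (inj₁ (_ , _ , t)) = ternEdge-irrefl t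
ternEdge-irrefl {x = _ ∷ _} {_ ∷ _} (inj₂ (a≢a , _ , _)) = a≢a refl

Tern : ℕ → Hypergraph
Tern n = record
  { V     = 3 ^ n
  ; edge  = λ x y z → does (edge? x y z)
  ; sym₁₂ = λ x y z → does-⇔ (mk⇔ ternEdge-swap₁₂ ternEdge-swap₁₂) (edge? x y z) (edge? y x z)
  ; sym₂₃ = λ x y z → does-⇔ (mk⇔ ternEdge-swap₂₃ ternEdge-swap₂₃) (edge? x y z) (edge? x z y)
  ; loop  = λ x z → dec-false (edge? x x z) ternEdge-irrefl
  }
  where
  edge? : (x y z : Fin (3 ^ n)) → Dec (TernEdge (fromFin n x) (fromFin n y) (fromFin n z))
  edge? x y z = ternEdge? (fromFin n x) (fromFin n y) (fromFin n z)

Tern-edge⁻ : ∀ n {x y z} → Edge (Tern n) x y z → TernEdge (fromFin n x) (fromFin n y) (fromFin n z)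
Tern-edge⁻ n {x} {y} {z} = does-sound (ternEdge? (fromFin n x) (fromFin n y) (fromFin n z))

Tern-edge⁺ : ∀ n {a b c} → TernEdge a b c → Edge (Tern n) (toFin n a) (toFin n b) (toFin n c)
Tern-edge⁺ n {a} {b} {c} t =
  does-complete (ternEdge? (fromFin n (toFin n a)) (fromFin n (toFin n b)) (fromFin n (toFin n c))) decoded
  where
  decoded : TernEdge (fromFin n (toFin n a)) (fromFin n (toFin n b)) (fromFin n (toFin n c))
  decoded rewrite fromFin-toFin n a | fromFin-toFin n b | fromFin-toFin n c = t

unique-words-bound : ∀ {n} {S : List (Word n)} → Unique S → length S ≤ 3 ^ n
unique-words-bound {n} {S} u = begin
  length S                  ≡⟨ sym (length-map (toFin n) S) ⟩
  length (map (toFin n) S)  ≤⟨ unique-⊆-length (Unique.map⁺ (toFin-injective n) u) (λ _ → ∈-allFin _) ⟩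
  length (allFin (3 ^ n))   ≡⟨ length-tabulate (λ i → i) ⟩
  3 ^ n                     ∎

part : ∀ {n} → Fin 3 → List (Word (suc n)) → List (Word n)
part c S = map tail (filter (λ w → head w Fin.≟ c) S)

part⁺ : ∀ {n c} {w : Word n} (S : List (Word (suc n))) → (c ∷ w) ∈ S → w ∈ part c S
part⁺ {c = c} S cw∈S = ∈-map⁺ tail (∈-filter⁺ (λ w → head w Fin.≟ c) cw∈S refl)

part⁻ : ∀ {n c} {w : Word n} (S : List (Word (suc n))) → w ∈ part c S → (c ∷ w) ∈ S
part⁻ {c = c} S w∈part with ∈-map⁻ tail w∈part
... | (_ ∷ _ , cw∈filter , refl) with ∈-filter⁻ (λ w → head w Fin.≟ c) {xs = S} cw∈filter
...   | (cw∈S , refl) = cw∈S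

length-part : ∀ {n} c (S : List (Word (suc n))) → length (part c S) ≤ length S
length-part c S = ≤-trans (≤-reflexive (length-map tail (filter (λ w → head w Fin.≟ c) S)))
                          (length-filter (λ w → head w Fin.≟ c) S)

length-part-< : ∀ {n} c (S : List (Word (suc n))) → ¬ All (λ w → head w ≡ c) S →
  length (part c S) < length S
length-part-< c S ¬all =
  ℕP.≤-<-trans (≤-reflexive (length-map tail (filter (λ w → head w Fin.≟ c) S)))
    (filter-notAll (λ w → head w Fin.≟ c) S (¬All⇒Any¬ (λ w → head w Fin.≟ c) S ¬all))

length-parts : ∀ {n} (S : List (Word (suc n))) →
  length S ≡ length (part 0F S) + (length (part 1F S) + length (part 2F S))
length-parts [] = refl
length-parts ((0F ∷ _) ∷ S) = cong suc (length-parts S)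
length-parts ((sucF 0F ∷ _) ∷ S) = trans (cong suc (length-parts S)) (sym (ℕP.+-suc _ _))
length-parts ((sucF (sucF 0F) ∷ _) ∷ S) =
  trans (cong suc (length-parts S))
        (sym (+-suc₂ (length (part 0F S)) (length (part 1F S)) (length (part 2F S))))
  where
  +-suc₂ : ∀ a b c → a + (b + suc c) ≡ suc (a + (b + c))
  +-suc₂ = solve-∀

tail-unique : ∀ {n c} {S : List (Word (suc n))} →
  All (λ w → head w ≡ c) S → Unique S → Unique (map tail S)
tail-unique [] [] = []
tail-unique {n} {S = w ∷ S} (w≡c ∷ heads) (w∉S ∷ u) = All.tabulate tail-distinct ∷ tail-unique heads u
  where
  tail-distinct : ∀ {v} → v ∈ map tail S → tail w ≢ v
  tail-distinct v∈ with ∈-map⁻ tail v∈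
  ... | (w′ , w′∈S , refl) = λ tails≡ →
    All.lookup w∉S w′∈S (same-head w w′ (trans w≡c (sym (All.lookup heads w′∈S))) tails≡)
    where
    same-head : ∀ (x y : Word (suc n)) → head x ≡ head y → tail x ≡ tail y → x ≡ y
    same-head (_ ∷ _) (_ ∷ _) refl refl = refl

part-unique : ∀ {n} c {S : List (Word (suc n))} → Unique S → Unique (part c S)
part-unique c {S} u =
  tail-unique (all-filter (λ w → head w Fin.≟ c) S) (filter⁺ (λ w → head w Fin.≟ c) u)

data Split {n} (S : List (Word (suc n))) : Set where
  constant  : ∀ c → All (λ w → head w ≡ c) S → Split S
  branching : (∀ c → length (part c S) < length S) → Split S

split : ∀ {n} (S : List (Word (suc n))) → Split S
split S with any? (λ c → All.all? (λ w → head w Fin.≟ c) S)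
... | yes (c , all-c) = constant c all-c
... | no ¬constant    = branching λ c → length-part-< c S (λ all-c → ¬constant (c , all-c))

-- Compression of words to length m relative to a set S with |S| ≤ m: drop every
-- coordinate on which the words of the current branch of S agree.  Along any
-- path at most |S| coordinates are kept, since each kept one shrinks the branch.
compress : ∀ {n} (S : List (Word n)) (m : ℕ) → Word n → Word m
compressWith : ∀ {n} (S : List (Word (suc n))) (m : ℕ) → Split S → Fin 3 → Word n → Word m
compress {zero}  S m _        = replicate m 0F
compress {suc n} S m (x ∷ xs) = compressWith S m (split S) x xs
compressWith S m       (constant c _) x xs = compress (part c S) m xs
compressWith S zero    (branching _)  x xs = []
compressWith S (suc m) (branching _)  x xs = x ∷ compress (part x S) m xs

compress-injective : ∀ {n} (S : List (Word n)) m → length S ≤ m →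
  ∀ {x y} → x ∈ S → y ∈ S → compress S m x ≡ compress S m y → x ≡ y
compress-injective {zero} S m _ {[]} {[]} _ _ _ = refl
compress-injective {suc n} S m |S|≤m {a ∷ xs} {b ∷ ys} x∈S y∈S = bySplit (split S) m |S|≤m
  where
  bySplit : (s : Split S) (m : ℕ) → length S ≤ m →
    compressWith S m s a xs ≡ compressWith S m s b ys → a ∷ xs ≡ b ∷ ys
  bySplit (constant c heads) m |S|≤m eq
    with refl ← All.lookup heads x∈S | refl ← All.lookup heads y∈S =
    cong (c ∷_) (compress-injective (part c S) m (≤-trans (length-part c S) |S|≤m)
                   (part⁺ S x∈S) (part⁺ S y∈S) eq)
  bySplit (branching _) zero |S|≤0 _ = ⊥-elim (∈⇒nonempty x∈S |S|≤0)
  bySplit (branching smaller) (suc m) |S|≤1+m eq with refl , eq′ ← ∷-injective eq =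
    cong (a ∷_) (compress-injective (part a S) m (ℕP.≤-pred (ℕP.<-≤-trans (smaller a) |S|≤1+m))
                   (part⁺ S x∈S) (part⁺ S y∈S) eq′)

compress-edge : ∀ {n} (S : List (Word n)) m → length S ≤ m →
  ∀ {x y z} → x ∈ S → y ∈ S → z ∈ S →
  TernEdge x y z → TernEdge (compress S m x) (compress S m y) (compress S m z)
compress-edge {zero} S m _ {[]} {[]} {[]} _ _ _ ()
compress-edge {suc n} S m |S|≤m {a ∷ xs} {b ∷ ys} {c ∷ zs} x∈S y∈S z∈S = bySplit (split S) m |S|≤m
  where
  bySplit : (s : Split S) (m : ℕ) → length S ≤ m → TernEdge (a ∷ xs) (b ∷ ys) (c ∷ zs) →
    TernEdge (compressWith S m s a xs) (compressWith S m s b ys) (compressWith S m s c zs)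
  bySplit (constant d heads) m |S|≤m (inj₁ (_ , _ , t))
    with refl ← All.lookup heads x∈S | refl ← All.lookup heads y∈S | refl ← All.lookup heads z∈S =
    compress-edge (part d S) m (≤-trans (length-part d S) |S|≤m)
                  (part⁺ S x∈S) (part⁺ S y∈S) (part⁺ S z∈S) t
  bySplit (constant d heads) m |S|≤m (inj₂ (a≢b , _ , _)) =
    ⊥-elim (a≢b (trans (All.lookup heads x∈S) (sym (All.lookup heads y∈S))))
  bySplit (branching _) zero |S|≤0 _ = ⊥-elim (∈⇒nonempty x∈S |S|≤0)
  bySplit (branching smaller) (suc m) |S|≤1+m (inj₁ (refl , refl , t′)) =
    inj₁ (refl , refl , compress-edge (part a S) m (ℕP.≤-pred (ℕP.<-≤-trans (smaller a) |S|≤1+m))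
                          (part⁺ S x∈S) (part⁺ S y∈S) (part⁺ S z∈S) t′)
  bySplit (branching _) (suc m) _ (inj₂ distinct) = inj₂ distinct

compress-embedding : ∀ F n → F ⊑ Tern n → F ⊑T V F
compress-embedding F n (f , f-injective , f-edge) = compress S ℓ ∘ word , injective , preserves
  where
  ℓ = V F
  word : Fin ℓ → Word n
  word i = fromFin n (f i)
  S : List (Word n)
  S = map word (allFin ℓ)
  |S|≤ℓ : length S ≤ ℓ
  |S|≤ℓ = ≤-reflexive (trans (length-map word (allFin ℓ)) (length-tabulate (λ i → i)))
  word∈S : ∀ i → word i ∈ S
  word∈S i = ∈-map⁺ word (∈-allFin i)
  injective : Injective _≡_ _≡_ (compress S ℓ ∘ word)
  injective {i} {j} eq = f-injective (fromFin-injective n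
    (compress-injective S ℓ |S|≤ℓ (word∈S i) (word∈S j) eq))
  preserves : ∀ x y z → Edge F x y z →
    TernEdge (compress S ℓ (word x)) (compress S ℓ (word y)) (compress S ℓ (word z))
  preserves x y z e =
    compress-edge S ℓ |S|≤ℓ (word∈S x) (word∈S y) (word∈S z) (Tern-edge⁻ n (f-edge x y z e))

cube : ℕ → ℕ
cube x = x * x * x

cube-triple : ∀ B → (3 * B) * (3 * B) * (3 * B) ≡ 27 * (B * B * B)
cube-triple = solve-∀

-- The case j = 0: a set of at most Y > 0 words never reaches (4/3)·Y.
not-four-thirds : ∀ Y m → 1 ≤ Y → m ≤ Y → ¬ (4 * (1 * Y) ≤ 3 * (1 * m))
not-four-thirds Y m 1≤Y m≤Y 4Y≤3m = ℕP.<-irrefl refl (begin-strict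
  3 * (1 * m)      ≤⟨ ℕP.*-monoʳ-≤ 3 (ℕP.*-monoʳ-≤ 1 m≤Y) ⟩
  3 * (1 * Y)      <⟨ ℕP.m<m+n (3 * (1 * Y)) 1≤Y ⟩
  3 * (1 * Y) + Y  ≡⟨ three-plus-one Y ⟩
  4 * (1 * Y)      ≤⟨ 4Y≤3m ⟩
  3 * (1 * m)      ∎)
  where
  three-plus-one : ∀ Y → 3 * (1 * Y) + Y ≡ 4 * (1 * Y)
  three-plus-one = solve-∀

-- The density hypothesis at level j+1, rewritten as a statement about the three parts.
threshold-parts : ∀ A B X m₀ m₁ m₂ →
  4 * ((3 * A) * (3 * B)) ≤ 3 * ((4 * X) * (m₀ + (m₁ + m₂))) →
  9 * (A * B) ≤ 3 * (X * m₀) + (3 * (X * m₁) + 3 * (X * m₂))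
threshold-parts A B X m₀ m₁ m₂ h = ℕP.*-cancelˡ-≤ 4 (subst₂ _≤_ (lhs A B) (rhs X m₀ m₁ m₂) h)
  where
  lhs : ∀ A B → 4 * ((3 * A) * (3 * B)) ≡ 4 * (9 * (A * B))
  lhs = solve-∀
  rhs : ∀ X m₀ m₁ m₂ →
    3 * ((4 * X) * (m₀ + (m₁ + m₂))) ≡ 4 * (3 * (X * m₀) + (3 * (X * m₁) + 3 * (X * m₂)))
  rhs = solve-∀

all-or-one-large : ∀ Y a b c → 9 * Y ≤ a + (b + c) →
  (Y ≤ a × Y ≤ b × Y ≤ c) ⊎ (4 * Y ≤ a ⊎ 4 * Y ≤ b ⊎ 4 * Y ≤ c)
all-or-one-large Y a b c sum with 4 * Y ≤? a | 4 * Y ≤? b | 4 * Y ≤? c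
... | yes large | _         | _         = inj₂ (inj₁ large)
... | no _      | yes large | _         = inj₂ (inj₂ (inj₁ large))
... | no _      | no _      | yes large = inj₂ (inj₂ (inj₂ large))
... | no a≱4Y   | no b≱4Y   | no c≱4Y   =
  inj₁ ( at-least refl (ℕP.≰⇒> b≱4Y) (ℕP.≰⇒> c≱4Y)
       , at-least (second-first a b c) (ℕP.≰⇒> a≱4Y) (ℕP.≰⇒> c≱4Y)
       , at-least (third-first a b c) (ℕP.≰⇒> a≱4Y) (ℕP.≰⇒> b≱4Y) )
  where
  second-first : ∀ x y z → y + (x + z) ≡ x + (y + z)
  second-first = solve-∀
  third-first : ∀ x y z → z + (x + y) ≡ x + (y + z)
  third-first = solve-∀
  nine : ∀ Y → Y + (4 * Y + 4 * Y) ≡ 9 * Y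
  nine = solve-∀
  -- if x were below Y, the sum would be below Y + 4Y + 4Y = 9Y
  at-least : ∀ {x y z} → x + (y + z) ≡ a + (b + c) → y < 4 * Y → z < 4 * Y → Y ≤ x
  at-least {x} {y} {z} eq y<4Y z<4Y with Y ≤? x
  ... | yes Y≤x = Y≤x
  ... | no Y≰x  = ⊥-elim (ℕP.<-irrefl refl (begin-strict
    a + (b + c)       ≡⟨ sym eq ⟩
    x + (y + z)       <⟨ ℕP.+-mono-<-≤ (ℕP.≰⇒> Y≰x) (+-mono-≤ (ℕP.<⇒≤ y<4Y) (ℕP.<⇒≤ z<4Y)) ⟩
    Y + (4 * Y + 4 * Y) ≡⟨ nine Y ⟩
    9 * Y             ≤⟨ sum ⟩
    a + (b + c)       ∎))

cross-bound : ∀ A B X d m₀ m₁ m₂ → 1 ≤ A →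
  A * B ≤ 3 * (X * m₀) → A * B ≤ 3 * (X * m₁) → A * B ≤ 3 * (X * m₂) →
  cube (3 * B) ≤ (27 * d + 729 * cube X) * (m₀ * (m₁ * m₂))
cross-bound A B X d m₀ m₁ m₂ 1≤A h₀ h₁ h₂ = begin
  cube (3 * B)
    ≡⟨ cube-triple B ⟩
  27 * cube B
    ≤⟨ ℕP.*-monoʳ-≤ 27 (*-mono-≤ (*-mono-≤ B≤AB B≤AB) B≤AB) ⟩
  27 * ((A * B) * (A * B) * (A * B))
    ≤⟨ ℕP.*-monoʳ-≤ 27 (*-mono-≤ (*-mono-≤ h₀ h₁) h₂) ⟩
  27 * ((3 * (X * m₀)) * (3 * (X * m₁)) * (3 * (X * m₂)))
    ≡⟨ expand X m₀ m₁ m₂ ⟩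
  729 * (X * X * X) * (m₀ * (m₁ * m₂))
    ≤⟨ ℕP.*-monoˡ-≤ (m₀ * (m₁ * m₂)) (ℕP.m≤n+m _ (27 * d)) ⟩
  (27 * d + 729 * cube X) * (m₀ * (m₁ * m₂)) ∎
  where
  B≤AB : B ≤ A * B
  B≤AB = ℕP.≤-trans (≤-reflexive (sym (ℕP.*-identityˡ B))) (ℕP.*-monoˡ-≤ B 1≤A)
  expand : ∀ X m₀ m₁ m₂ →
    27 * ((3 * (X * m₀)) * (3 * (X * m₁)) * (3 * (X * m₂))) ≡ 729 * (X * X * X) * (m₀ * (m₁ * m₂))
  expand = solve-∀

lift-bound : ∀ B d e l → cube B ≤ d * l → cube (3 * B) ≤ (27 * d + e) * l
lift-bound B d e l h = begin
  cube (3 * B)      ≡⟨ cube-triple B ⟩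
  27 * cube B       ≤⟨ ℕP.*-monoʳ-≤ 27 h ⟩
  27 * (d * l)      ≡⟨ sym (ℕP.*-assoc 27 d l) ⟩
  27 * d * l        ≤⟨ ℕP.*-monoˡ-≤ l (ℕP.m≤m+n (27 * d) e) ⟩
  (27 * d + e) * l  ∎

Triple : ℕ → Set
Triple n = Word n × Word n × Word n

Spanned : ∀ {n} → List (Word n) → Triple n → Set
Spanned S (a , b , c) = a ∈ S × b ∈ S × c ∈ S × a <ₗₑₓ b × b <ₗₑₓ c × TernEdge a b c

-- A certificate that S spans at least k / d hyperedges of T_n.
record ManySpanned {n} (S : List (Word n)) (d k : ℕ) : Set where
  constructor many
  field
    triples  : List (Triple n)
    distinct : Unique triples
    spanned  : All (Spanned S) triples
    enough   : k ≤ d * length triples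

-- Triples with first letters 0, 1, 2 are hyperedges decided at the first coordinate.
crossTriples : ∀ {n} → List (Word (suc n)) → List (Triple (suc n))
crossTriples S = cartesianProduct (map (0F ∷_) (part 0F S))
                   (cartesianProduct (map (1F ∷_) (part 1F S)) (map (2F ∷_) (part 2F S)))

length-crossTriples : ∀ {n} (S : List (Word (suc n))) →
  length (crossTriples S) ≡ length (part 0F S) * (length (part 1F S) * length (part 2F S))
length-crossTriples S = begin-equality
  length (crossTriples S)
    ≡⟨ length-cartesianProduct (prefixed 0F) (cartesianProduct (prefixed 1F) (prefixed 2F)) ⟩
  length (prefixed 0F) * length (cartesianProduct (prefixed 1F) (prefixed 2F))
    ≡⟨ cong₂ _*_ (|prefixed| 0F) (length-cartesianProduct (prefixed 1F) (prefixed 2F)) ⟩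
  length (part 0F S) * (length (prefixed 1F) * length (prefixed 2F))
    ≡⟨ cong (λ k → length (part 0F S) * k) (cong₂ _*_ (|prefixed| 1F) (|prefixed| 2F)) ⟩
  length (part 0F S) * (length (part 1F S) * length (part 2F S)) ∎
  where
  prefixed : Fin 3 → List (Word (suc _))
  prefixed c = map (c ∷_) (part c S)
  |prefixed| : ∀ c → length (prefixed c) ≡ length (part c S)
  |prefixed| c = length-map (c ∷_) (part c S)

crossTriples-unique : ∀ {n} {S : List (Word (suc n))} → Unique S → Unique (crossTriples S)
crossTriples-unique {n} {S} u =
  cartesianProduct⁺ (prefixed-unique 0F) (cartesianProduct⁺ (prefixed-unique 1F) (prefixed-unique 2F))
  where
  prefixed-unique : ∀ c → Unique (map (c ∷_) (part c S))
  prefixed-unique c = Unique.map⁺ ∷-injectiveʳ (part-unique c u)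

crossTriples-spanned : ∀ {n} (S : List (Word (suc n))) → All (Spanned S) (crossTriples S)
crossTriples-spanned S = All.tabulate spanned
  where
  prefixed⁻ : ∀ c {w} → w ∈ map (c ∷_) (part c S) → w ∈ S × head w ≡ c
  prefixed⁻ c w∈ with ∈-map⁻ (c ∷_) w∈
  ... | (_ , v∈part , refl) = part⁻ S v∈part , refl
  spanned : ∀ {t} → t ∈ crossTriples S → Spanned S t
  spanned {a@(_ ∷ _) , b@(_ ∷ _) , c@(_ ∷ _)} t∈
    with ∈-cartesianProduct⁻ (map (0F ∷_) (part 0F S)) _ t∈
  ... | a∈ , bc∈ with ∈-cartesianProduct⁻ (map (1F ∷_) (part 1F S)) _ bc∈
  ... | b∈ , c∈ with prefixed⁻ 0F a∈ | prefixed⁻ 1F b∈ | prefixed⁻ 2F c∈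
  ... | a∈S , refl | b∈S , refl | c∈S , refl =
    a∈S , b∈S , c∈S , this (s≤s z≤n) refl , this (s≤s (s≤s z≤n)) refl ,
    inj₂ ((λ ()) , (λ ()) , (λ ()))

extend : ∀ {n} → Fin 3 → Triple n → Triple (suc n)
extend c (a , b , d) = (c ∷ a) , (c ∷ b) , (c ∷ d)

extend-injective : ∀ {n} c {s t : Triple n} → extend c s ≡ extend c t → s ≡ t
extend-injective c {_ , _ , _} {_ , _ , _} refl = refl

extend-spanned : ∀ {n} c (S : List (Word (suc n))) {t} → Spanned (part c S) t → Spanned S (extend c t)
extend-spanned c S (a∈ , b∈ , d∈ , a<b , b<d , t) =
  part⁻ S a∈ , part⁻ S b∈ , part⁻ S d∈ , next refl a<b , next refl b<d , inj₁ (refl , refl , t)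

extend-many : ∀ {n} c (S : List (Word (suc n))) {d e B} →
  ManySpanned (part c S) d (cube B) → ManySpanned S (27 * d + e) (cube (3 * B))
extend-many c S {d} {e} {B} (many L distinct spanned enough) =
  many (map (extend c) L)
       (Unique.map⁺ (extend-injective c) distinct)
       (All.map⁺ (All.map (extend-spanned c S) spanned))
       (subst (λ l → cube (3 * B) ≤ (27 * d + e) * l) (sym (length-map (extend c) L))
              (lift-bound B d e (length L) enough))

D : ℕ → ℕ
D zero    = 1
D (suc j) = 27 * D j + 729 * cube (4 ^ j)

-- Split S by first letter: if every part has at least
-- (1/3)(3/4)ʲ 3ⁿ words, the triples across parts suffice; otherwise some part has at least
-- (4/3)(3/4)ʲ 3ⁿ words, i.e. it is dense at level j in T_n, and induction applies.
spanned-count : ∀ j n → j ≤ n → (S : List (Word n)) → Unique S →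
  4 * (3 ^ j * 3 ^ n) ≤ 3 * (4 ^ j * length S) → ManySpanned S (D j) (cube (3 ^ n))
spanned-count zero n _ S u dense =
  ⊥-elim (not-four-thirds (3 ^ n) (length S) (ℕP.m^n>0 3 n) (unique-words-bound u) dense)
spanned-count (suc j) (suc n) (s≤s j≤n) S u dense =
  by-size (all-or-one-large (A * B) (3 * (X * m₀)) (3 * (X * m₁)) (3 * (X * m₂)) parts-dense)
  where
  A = 3 ^ j
  B = 3 ^ n
  X = 4 ^ j
  m₀ = length (part 0F S)
  m₁ = length (part 1F S)
  m₂ = length (part 2F S)
  parts-dense : 9 * (A * B) ≤ 3 * (X * m₀) + (3 * (X * m₁) + 3 * (X * m₂))
  parts-dense = threshold-parts A B X m₀ m₁ m₂
    (subst (λ m → 4 * ((3 * A) * (3 * B)) ≤ 3 * ((4 * X) * m)) (length-parts S) dense)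
  from-part : ∀ c → 4 * (A * B) ≤ 3 * (X * length (part c S)) → ManySpanned S (D (suc j)) (cube (3 * B))
  from-part c dense-c = extend-many c S {B = B} (spanned-count j n j≤n (part c S) (part-unique c u) dense-c)
  by-size : (A * B ≤ 3 * (X * m₀) × A * B ≤ 3 * (X * m₁) × A * B ≤ 3 * (X * m₂)) ⊎
            (4 * (A * B) ≤ 3 * (X * m₀) ⊎ 4 * (A * B) ≤ 3 * (X * m₁) ⊎ 4 * (A * B) ≤ 3 * (X * m₂)) →
            ManySpanned S (D (suc j)) (cube (3 * B))
  by-size (inj₁ (h₀ , h₁ , h₂)) =
    many (crossTriples S) (crossTriples-unique u) (crossTriples-spanned S)
      (subst (λ l → cube (3 * B) ≤ D (suc j) * l) (sym (length-crossTriples S))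
        (cross-bound A B X (D j) m₀ m₁ m₂ (ℕP.m^n>0 3 j) h₀ h₁ h₂))
  by-size (inj₂ (inj₁ dense₀))        = from-part 0F dense₀
  by-size (inj₂ (inj₂ (inj₁ dense₁))) = from-part 1F dense₁
  by-size (inj₂ (inj₂ (inj₂ dense₂))) = from-part 2F dense₂

-- The ordered vertex triples scanned by edgesIn and the test it applies to them; by
-- definition edgesIn H U is the length of filterᵇ (counted H U) (allTriples (V H)).
allTriples : (N : ℕ) → List (Fin N × Fin N × Fin N)
allTriples N = concatMap (λ i → concatMap (λ j → concatMap (λ k →
                 [ (i , j , k) ]) (allFin N)) (allFin N)) (allFin N)

counted : (H : Hypergraph) → Subset (V H) → Fin (V H) × Fin (V H) × Fin (V H) → Bool
counted H U (i , j , k) =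
  (suc (toℕ i) ≤ᵇ toℕ j) ∧ (suc (toℕ j) ≤ᵇ toℕ k) ∧ lookup U i ∧ lookup U j ∧ lookup U k ∧ edge H i j k

∈-allTriples : ∀ N (t : Fin N × Fin N × Fin N) → t ∈ allTriples N
∈-allTriples N (i , j , k) = in-block i (in-block j (in-block k (here refl)))
  where
  in-block : ∀ {B : Set} {f : Fin N → List B} {y} (i : Fin N) → y ∈ f i → y ∈ concatMap f (allFin N)
  in-block {f = f} i y∈fi = ∈-concatMap⁺ f (Any.map (λ { refl → y∈fi }) (∈-allFin i))

members : ∀ {N} → Subset N → List (Fin N)
members {N} U = filterᵇ (lookup U) (allFin N)

length-members : ∀ {N} (U : Subset N) → length (members U) ≡ ∣ U ∣
length-members U = length-filter-tabulate U (λ i → i) (λ _ → refl)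
  where
  length-filter-tabulate : ∀ {A : Set} {N} (U : Subset N) (f : Fin N → A) {p : A → Bool} →
    (∀ i → p (f i) ≡ lookup U i) → length (filterᵇ p (tabulate f)) ≡ ∣ U ∣
  length-filter-tabulate [] f eq = refl
  length-filter-tabulate (true ∷ U) f {p} eq rewrite eq 0F =
    cong suc (length-filter-tabulate U (λ i → f (sucF i)) (λ i → eq (sucF i)))
  length-filter-tabulate (false ∷ U) f {p} eq rewrite eq 0F =
    length-filter-tabulate U (λ i → f (sucF i)) (λ i → eq (sucF i))

words : ∀ n → Subset (3 ^ n) → List (Word n)
words n U = map (fromFin n) (members U)

words-unique : ∀ n (U : Subset (3 ^ n)) → Unique (words n U)
words-unique n U =
  Unique.map⁺ (fromFin-injective n) (filter⁺ (λ i → T? (lookup U i)) (allFin⁺ (3 ^ n)))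

words-in : ∀ n (U : Subset (3 ^ n)) {w} → w ∈ words n U → T (lookup U (toFin n w))
words-in n U w∈ with ∈-map⁻ (fromFin n) w∈
... | i , i∈ , refl = subst (λ k → T (lookup U k)) (sym (toFin-fromFin n i))
                        (proj₂ (∈-filter⁻ (λ i → T? (lookup U i)) {xs = allFin (3 ^ n)} i∈))

spanned≤edgesIn : ∀ n (U : Subset (3 ^ n)) (L : List (Triple n)) →
  Unique L → All (Spanned (words n U)) L → length L ≤ edgesIn (Tern n) U
spanned≤edgesIn n U L distinct spanned = begin
  length L               ≡⟨ sym (length-map encode L) ⟩
  length (map encode L)  ≤⟨ unique-⊆-length (Unique.map⁺ encode-injective distinct) encoded-counted ⟩
  edgesIn (Tern n) U     ∎
  where
  encode : Triple n → Fin (3 ^ n) × Fin (3 ^ n) × Fin (3 ^ n)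
  encode (a , b , c) = toFin n a , toFin n b , toFin n c
  encode-injective : ∀ {s t} → encode s ≡ encode t → s ≡ t
  encode-injective {a , b , c} {a′ , b′ , c′} eq
    with refl ← toFin-injective n (cong proj₁ eq)
       | refl ← toFin-injective n (cong (proj₁ ∘ proj₂) eq)
       | refl ← toFin-injective n (cong (proj₂ ∘ proj₂) eq) = refl
  passes : ∀ {t} → Spanned (words n U) t → T (counted (Tern n) U (encode t))
  passes (a∈ , b∈ , c∈ , a<b , b<c , e) =
    ∧-intro (ℕP.≤⇒≤ᵇ (toFin-mono n a<b)) (∧-intro (ℕP.≤⇒≤ᵇ (toFin-mono n b<c))
      (∧-intro (words-in n U a∈) (∧-intro (words-in n U b∈) (∧-intro (words-in n U c∈) (Tern-edge⁺ n e)))))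
  encoded-counted : ∀ {x} → x ∈ map encode L → x ∈ filterᵇ (counted (Tern n) U) (allTriples (3 ^ n))
  encoded-counted x∈ with ∈-map⁻ encode x∈
  ... | t , t∈L , refl = ∈-filter⁺ (λ x → T? (counted (Tern n) U x)) (∈-allTriples (3 ^ n) (encode t))
                           (passes (All.lookup spanned t∈L))

Tern-dense-ℕ : ∀ j n → j ≤ n → (U : Subset (3 ^ n)) →
  4 * (3 ^ j * 3 ^ n) ≤ 3 * (4 ^ j * ∣ U ∣) → cube (3 ^ n) ≤ D j * edgesIn (Tern n) U
Tern-dense-ℕ j n j≤n U dense =
  ≤-trans enough (ℕP.*-monoʳ-≤ (D j) (spanned≤edgesIn n U triples distinct spanned))
  where
  |words|≡|U| : length (words n U) ≡ ∣ U ∣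
  |words|≡|U| = trans (length-map (fromFin n) (members U)) (length-members U)
  open ManySpanned (spanned-count j n j≤n (words n U) (words-unique n U)
    (subst (λ m → 4 * (3 ^ j * 3 ^ n) ≤ 3 * (4 ^ j * m)) (sym |words|≡|U|) dense))

ℕ→ℚ≡mkℚ : ∀ n → ℕ→ℚ n ≡ mkℚ (+ n) 0 (coprime-sym (1-coprimeTo n))
ℕ→ℚ≡mkℚ n = normalize-coprime (coprime-sym (1-coprimeTo n))

scaled-≤ : ∀ u v .(c : Coprime u (suc v)) a b →
  (mkℚ (+ u) v c ℚ.* ℕ→ℚ a ℚ.≤ ℕ→ℚ b) ⇔ (u * a ≤ suc v * b)
scaled-≤ u v c a b = mk⇔
  (λ le → to-ℕ (cross-multiplied (subst₂ Scaled (ℕ→ℚ≡mkℚ a) (ℕ→ℚ≡mkℚ b) le)))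
  (λ le → subst₂ Scaled (sym (ℕ→ℚ≡mkℚ a)) (sym (ℕ→ℚ≡mkℚ b)) (from-ℕ le))
  where
  p = mkℚ (+ u) v c
  Scaled = λ x y → p ℚ.* x ℚ.≤ y
  a′ = mkℚ (+ a) 0 (coprime-sym (1-coprimeTo a))
  b′ = mkℚ (+ b) 0 (coprime-sym (1-coprimeTo b))
  Crossed = (+ u ℤ.* + a) ℤ.* + 1 ℤ.≤ + b ℤ.* + (suc v * 1)
  cross-multiplied : p ℚ.* a′ ℚ.≤ b′ → Crossed
  cross-multiplied le with ≤-respˡ-≃ (toℚᵘ-homo-* p a′) (toℚᵘ-mono-≤ le)
  ... | *≤* crossed = crossed
  uncross : Crossed → p ℚ.* a′ ℚ.≤ b′
  uncross crossed = toℚᵘ-cancel-≤ (≤-respˡ-≃ (≃-sym (toℚᵘ-homo-* p a′)) (*≤* crossed))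
  lhs : + (u * a) ≡ (+ u ℤ.* + a) ℤ.* + 1
  lhs = trans (cong +_ (sym (ℕP.*-identityʳ (u * a))))
              (trans (pos-* (u * a) 1) (cong (ℤ._* + 1) (pos-* u a)))
  rhs : + (suc v * b) ≡ + b ℤ.* + (suc v * 1)
  rhs = trans (cong +_ (commute v b)) (pos-* b (suc v * 1))
    where
    commute : ∀ v b → suc v * b ≡ b * (suc v * 1)
    commute = solve-∀
  to-ℕ : Crossed → u * a ≤ suc v * b
  to-ℕ crossed = drop‿+≤+ (subst₂ ℤ._≤_ (sym lhs) (sym rhs) crossed)
  from-ℕ : u * a ≤ suc v * b → p ℚ.* a′ ℚ.≤ b′
  from-ℕ le = uncross (subst₂ ℤ._≤_ lhs rhs (+≤+ le))

bernoulli : ∀ j → 3 ^ j * (3 + j) ≤ 3 * 4 ^ j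
bernoulli zero = ≤-refl
bernoulli (suc j) = begin
  3 * 3 ^ j * (3 + suc j)             ≡⟨ unfold (3 ^ j) j ⟩
  3 * (3 ^ j * (3 + j)) + 3 * 3 ^ j   ≤⟨ ℕP.+-mono-≤ (ℕP.*-monoʳ-≤ 3 (bernoulli j))
                                            (ℕP.*-monoʳ-≤ 3 (ℕP.^-monoˡ-≤ j (ℕP.n≤1+n 3))) ⟩
  3 * (3 * 4 ^ j) + 3 * 4 ^ j         ≡⟨ refold (4 ^ j) ⟩
  3 * (4 * 4 ^ j)                     ∎
  where
  unfold : ∀ a j → 3 * a * (3 + suc j) ≡ 3 * (a * (3 + j)) + 3 * a
  unfold = solve-∀
  refold : ∀ b → 3 * (3 * b) + 3 * b ≡ 3 * (4 * b)
  refold = solve-∀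

level-threshold : ∀ q N m → N ≤ q * m → 4 * (3 ^ (4 * q) * N) ≤ 3 * (4 ^ (4 * q) * m)
level-threshold q N m N≤qm = begin
  4 * (3 ^ j * N)        ≤⟨ ℕP.*-monoʳ-≤ 4 (ℕP.*-monoʳ-≤ (3 ^ j) N≤qm) ⟩
  4 * (3 ^ j * (q * m))  ≡⟨ regroup (3 ^ j) q m ⟩
  3 ^ j * (4 * q) * m    ≤⟨ ℕP.*-monoˡ-≤ m (ℕP.*-monoʳ-≤ (3 ^ j) (ℕP.m≤n+m (4 * q) 3)) ⟩
  3 ^ j * (3 + j) * m    ≤⟨ ℕP.*-monoˡ-≤ m (bernoulli j) ⟩
  3 * 4 ^ j * m          ≡⟨ ℕP.*-assoc 3 (4 ^ j) m ⟩
  3 * (4 ^ j * m)        ∎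
  where
  j = 4 * q
  regroup : ∀ a q m → 4 * (a * (q * m)) ≡ a * (4 * q) * m
  regroup = solve-∀

nCk≤n^k : ∀ n k → n C k ≤ n ^ k
nCk≤n^k n zero = ≤-refl
nCk≤n^k zero (suc k) = z≤n
nCk≤n^k (suc n) (suc k) = begin
  suc n C suc k             ≡⟨ sym (nCk+nC[k+1]≡[n+1]C[k+1] n k) ⟩
  n C k + n C suc k         ≤⟨ ℕP.+-mono-≤ (nCk≤n^k n k) (nCk≤n^k n (suc k)) ⟩
  n ^ k + n * n ^ k         ≤⟨ ℕP.+-mono-≤ n^k≤ (ℕP.*-monoʳ-≤ n n^k≤) ⟩
  suc n ^ k + n * suc n ^ k ∎
  where
  n^k≤ : n ^ k ≤ suc n ^ k
  n^k≤ = ℕP.^-monoˡ-≤ k (ℕP.n≤1+n n)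

triples-bound : ∀ n (U : Subset (3 ^ n)) → ∣ U ∣ C 3 ≤ cube (3 ^ n)
triples-bound n U = begin
  ∣ U ∣ C 3   ≤⟨ nCk≤n^k ∣ U ∣ 3 ⟩
  ∣ U ∣ ^ 3   ≤⟨ ℕP.^-monoˡ-≤ 3 (∣p∣≤n U) ⟩
  (3 ^ n) ^ 3 ≡⟨ cubed (3 ^ n) ⟩
  cube (3 ^ n) ∎
  where
  cubed : ∀ a → a * (a * (a * 1)) ≡ a * a * a
  cubed = solve-∀

n≤3^n : ∀ n → n ≤ 3 ^ n
n≤3^n zero = z≤n
n≤3^n (suc n) = begin
  1 + n             ≤⟨ ℕP.+-mono-≤ (ℕP.m^n>0 3 n) (n≤3^n n) ⟩
  3 ^ n + 3 ^ n     ≤⟨ ℕP.m≤m+n (3 ^ n + 3 ^ n) (3 ^ n) ⟩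
  3 ^ n + 3 ^ n + 3 ^ n ≡⟨ triple (3 ^ n) ⟩
  3 * 3 ^ n         ∎
  where
  triple : ∀ a → a + a + a ≡ 3 * a
  triple = solve-∀

level : ℚ → ℕ
level η = 4 * ↧ₙ η

density : ℚ → ℚ
density η = mkℚ (+ 1) (suc (D (level η))) (1-coprimeTo _)

densityFn : DensityFn
densityFn = density , λ _ _ → ℚ.*<* (+<+ (s≤s z≤n)) , ℚ.*<* (+<+ (s≤s (s≤s z≤n)))

Tern-dense-at : ∀ η → 0ℚ ℚ.< η → ∀ n → level η ≤ n → (U : Subset (3 ^ n)) →
  η ℚ.* ℕ→ℚ (3 ^ n) ℚ.≤ ℕ→ℚ ∣ U ∣ →
  density η ℚ.* ℕ→ℚ (∣ U ∣ C 3) ℚ.≤ ℕ→ℚ (edgesIn (Tern n) U)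
Tern-dense-at η@(mkℚ +[1+ u ] v c) _ n level≤n U large =
  Equivalence.from (scaled-≤ 1 (suc (D j)) (1-coprimeTo _) (∣ U ∣ C 3) (edgesIn (Tern n) U)) (begin
    1 * (∣ U ∣ C 3)           ≡⟨ ℕP.*-identityˡ _ ⟩
    ∣ U ∣ C 3                 ≤⟨ triples-bound n U ⟩
    cube (3 ^ n)              ≤⟨ Tern-dense-ℕ j n level≤n U (level-threshold (suc v) _ _ 3ⁿ≤q|U|) ⟩
    D j * E                   ≤⟨ ℕP.*-monoˡ-≤ E (ℕP.m≤n+m (D j) 2) ⟩
    suc (suc (D j)) * E       ∎)
  where
  j = level η
  E = edgesIn (Tern n) U
  3ⁿ≤q|U| : 3 ^ n ≤ suc v * ∣ U ∣
  3ⁿ≤q|U| = ≤-trans (ℕP.m≤n*m (3 ^ n) (suc u))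
                    (Equivalence.to (scaled-≤ (suc u) v c (3 ^ n) ∣ U ∣) large)
Tern-dense-at (mkℚ (+ zero) _ _) (ℚ.*<* (+<+ ()))
Tern-dense-at (mkℚ -[1+ _ ] _ _) (ℚ.*<* ())

Tern-dense : Dense densityFn Tern
Tern-dense = (λ M → M , λ n M≤n → ≤-trans M≤n (n≤3^n n))
           , λ η (0<η , _) → level η , λ n → Tern-dense-at η 0<η n

lemma5p3 : (F : Hypergraph) → Frequent F → F ⊑T V F
lemma5p3 F frequent with frequent densityFn Tern Tern-dense
... | n₀ , embeds = compress-embedding F n₀ (embeds n₀ ≤-refl)
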